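{- Let $k\in\mathbb{Z}$ with $k\equiv \pm1,\pm5 \pmod{12}$. Then $\operatorname{Ker}\nu_{\eta^{2k}}=\operatorname{Ker}\nu_{\eta^{6}}\cap\operatorname{Ker}\nu_{\eta^{8}}$. Moreover, the matrices $S^n$ $(0\le n\le 11)$, where $S=\begin{pmatrix} 1&1\\ 0&1\end{pmatrix}$, form a complete set of coset representatives of $\Gamma(1)$ modulo $\operatorname{Ker}\nu_{\eta^{2k}}$.
   Context: Let $\Gamma(1)=SL(2,\mathbb{Z})$, acting on the upper half plane $\mathscr{H}=\{\tau\in\mathbb{C}:\Im\tau>0\}$ by $M\tau=\frac{a\tau+b}{c\tau+d}$ for $M=\begin{pmatrix} a&b\\ c&d\end{pmatrix}$. Let $\eta(\tau)=q^{1/24}\prod_{n\ge1}(1-q^n)$ with $q=e^{2\pi i\tau}$ and $q^{1/24}=e^{2\pi i\tau/24}$. For $m\in\mathbb{Z}$, the multiplier system $\nu_{\eta^{2m}}:\Gamma(1)\to\mathbb{C}^\times$ is defined by $\eta^{2m}(M\tau)=\nu_{\eta^{2m}}(M)(c\tau+d)^m\eta^{2m}(\tau)$ for all $\tau\in\mathscr{H}$; it is a character of $\Gamma(1)$, given explicitly by $\nu_{\eta^{2m}}(M)=\exp\{\frac{m\pi i}{6}f(M)\}$, where $f(M)=(a+d)c-bd(c^2-1)-3c$ if $c$ is odd and $f(M)=(a+d)c-bd(c^2-1)+3d-3-3cd$ if $c$ is even. $\operatorname{Ker}\nu_{\eta^{2m}}$ denotes its kernel (so $\nu_{\eta^{6}}$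 and $\nu_{\eta^8}$ are the cases $m=3$ and $m=4$). -}

module Defs where

open import Data.Nat as ℕ using (ℕ; zero; suc)
open import Data.Integer using (ℤ; +_; _+_; _-_; _*_; -_; ∣_∣)
open import Data.Integer.Divisibility using (_∣_)
open import Data.Bool using (Bool; if_then_else_)
open import Data.Product using (_×_)
open import Relation.Binary.PropositionalEquality using (_≡_)

record Mat : Set where
  constructor mat
  field
    a b c d : ℤ
open Mat public

det : Mat → ℤ
det (mat a b c d) = a * d - b * c

InΓ1 : Mat → Set
InΓ1 M = det M ≡ + 1

_·_ : Mat → Mat → Mat
mat a b c d · mat a' b' c' d' =
  mat (a * a' + b * c') (a * b' + b * d') (c * a' + d * c') (c * b' + d * d')

-- inverse of a determinant-1 matrix (the adjugate)
inv : Mat → Mat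
inv (mat a b c d) = mat d (- b) (- c) a

I : Mat
I = mat (+ 1) (+ 0) (+ 0) (+ 1)

S : Mat
S = mat (+ 1) (+ 1) (+ 0) (+ 1)

_^_ : Mat → ℕ → Mat
M ^ zero = I
M ^ suc n = M · (M ^ n)

cOdd : ℤ → Bool
cOdd c = (∣ c ∣ ℕ.% 2) ℕ.≡ᵇ 1

f : Mat → ℤ
f (mat a b c d) =
  if cOdd c
  then (a + d) * c - b * d * (c * c - + 1) - + 3 * c
  else (a + d) * c - b * d * (c * c - + 1) + + 3 * d - + 3 - + 3 * c * d

-- ν_{η^{2m}}(M) = exp(m π i f(M) / 6) = ζ₁₂^{m f(M)}, so
-- M ∈ Ker ν_{η^{2m}}  iff  12 ∣ m · f(M).
InKer : ℤ → Mat → Set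
InKer m M = (+ 12) ∣ (m * f M)

{-# OPTIONS --safe #-}
-- For M = (a b ; c d), left multiplication by S⁻ⁿ turns f(M) into
-- f(M) − n + n(c² − 1)(d² − 1), and for ad − bc = 1 the factor (c² − 1)(d² − 1)
-- is divisible by 12: if 3 divides neither c² − 1 nor d² − 1 then 3 divides both
-- c and d, hence ad − bc = 1, and likewise with 4 and 2. So f(S⁻ⁿM) ≡ f(M) − n
-- (mod 12). As k² ≡ 1 (mod 12), k is a unit modulo 12, so M ∈ Ker ν_{η^{2k}} iff
-- 12 ∣ f(M), which is also the condition for Ker ν_{η⁶} ∩ Ker ν_{η⁸}. Hence S⁻ⁿM
-- lies in the kernel iff n ≡ f(M) (mod 12).
module Submission where

open import Defs
open import Data.Nat using (ℕ)
open import Data.Fin using (Fin; toℕ)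
open import Data.Integer using (ℤ; +_; _+_; _-_)
open import Data.Integer.Divisibility using (_∣_)
open import Data.Sum using (_⊎_)
open import Data.Product using (_×_; ∃-syntax)
open import Function.Bundles using (_⇔_)
open import Relation.Binary.PropositionalEquality using (_≡_)

open import Data.Bool using (true; false)
open import Data.Empty using (⊥-elim)
open import Data.Fin using (fromℕ<)
open import Data.Fin.Properties using (toℕ-fromℕ<; toℕ-injective; toℕ<n)
open import Data.Integer using (_*_; -_; NonZero)
import Data.Integer as ℤ using (∣_∣)
open import Data.Integer.DivMod using (_%_; _/_; n%d<d; a≡a%n+[a/n]*n)
open import Data.Integer.Divisibility.Signed
  using (divides; ∣ᵤ⇒∣; ∣⇒∣ᵤ; ∣m∣n⇒∣m+n; ∣m∣n⇒∣m-n; ∣m+n∣n⇒∣m; ∣m⇒∣m*n; ∣n⇒∣m*n; *-monoʳ-∣)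
  renaming (_∣_ to _∣ˢ_)
open import Data.Integer.Properties
  using (+-injective; m-n≡m⊖n; ∣m⊝n∣≤m⊔n; ∣i∣≡0⇒i≡0; i-j≡0⇒i≡j)
open import Data.Integer.Tactic.RingSolver using (solve)
open import Data.List using ([]; _∷_)
import Data.Nat as ℕ
import Data.Nat.DivMod as ℕ
import Data.Nat.Divisibility as ℕ
import Data.Nat.Properties as ℕ
open import Data.Product using (_,_)
open import Data.Sum using (inj₁; inj₂)
open import Function.Base using (_∘_)
open import Function.Bundles using (mk⇔; module Equivalence)
import Function.Properties.Equivalence as ⇔
open import Relation.Binary.PropositionalEquality
  using (refl; sym; trans; cong; subst; module ≡-Reasoning)
open import Relation.Nullary using (¬_)

n∣m-m%n : ∀ m n .{{_ : NonZero n}} → n ∣ˢ m - + (m % n)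
n∣m-m%n m n = divides (m / n) (begin
  m - + (m % n)                     ≡⟨ cong (_- + (m % n)) (a≡a%n+[a/n]*n m n) ⟩
  + (m % n) + m / n * n - + (m % n) ≡⟨ r+x-r≡x (+ (m % n)) (m / n * n) ⟩
  m / n * n                         ∎)
  where
  open ≡-Reasoning
  r+x-r≡x : ∀ r x → r + x - r ≡ x
  r+x-r≡x r x = solve (r ∷ x ∷ [])

residues-unique : ∀ {d m n} .{{_ : ℕ.NonZero d}} →
                  m ℕ.< d → n ℕ.< d → + d ∣ˢ + m - + n → m ≡ n
residues-unique {d} {m} {n} m<d n<d d∣m-n =
  +-injective (i-j≡0⇒i≡j (+ m) (+ n) (∣i∣≡0⇒i≡0 ∣m-n∣≡0))
  where
  ∣m-n∣<d : ℤ.∣ + m - + n ∣ ℕ.< d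
  ∣m-n∣<d = subst (ℕ._< d) (cong ℤ.∣_∣ (sym (m-n≡m⊖n m n)))
              (ℕ.≤-<-trans (∣m⊝n∣≤m⊔n m n) (ℕ.⊔-pres-<m m<d n<d))
  ∣m-n∣≡0 : ℤ.∣ + m - + n ∣ ≡ 0
  ∣m-n∣≡0 = trans (sym (ℕ.m<n⇒m%n≡m ∣m-n∣<d)) (ℕ.n∣m⇒m%n≡0 _ d (∣⇒∣ᵤ d∣m-n))

nonTrivial⇒∤1 : ∀ p .{{_ : ℕ.NonTrivial p}} → ¬ + p ∣ˢ + 1
nonTrivial⇒∤1 p = ℕ.nonTrivial⇒≢1 {p} ∘ ℕ.∣1⇒≡1 ∘ ∣⇒∣ᵤ

∣m+n⇔∣m : ∀ {d m n} → d ∣ˢ n → d ∣ˢ m + n ⇔ d ∣ˢ m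
∣m+n⇔∣m d∣n = mk⇔ (λ d∣m+n → ∣m+n∣n⇒∣m d∣m+n d∣n) (λ d∣m → ∣m∣n⇒∣m+n d∣m d∣n)

∣k-s⇒∣k²-1 : ∀ {d} k s → d ∣ˢ k - s → d ∣ˢ s * s - + 1 → d ∣ˢ k * k - + 1
∣k-s⇒∣k²-1 {d} k s d∣k-s d∣s²-1 =
  subst (d ∣ˢ_) {(k - s) * (k + s) + (s * s - + 1)} (solve (k ∷ s ∷ []))
    (∣m∣n⇒∣m+n (∣m⇒∣m*n (k + s) d∣k-s) d∣s²-1)

∣k*n⇒∣n : ∀ {d} k {n} → d ∣ˢ k * k - + 1 → d ∣ˢ k * n → d ∣ˢ n
∣k*n⇒∣n {d} k {n} d∣k²-1 d∣kn =
  subst (d ∣ˢ_) {k * (k * n) - (k * k - + 1) * n} (solve (k ∷ n ∷ []))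
    (∣m∣n⇒∣m-n (∣n⇒∣m*n k d∣kn) (∣m⇒∣m*n n d∣k²-1))

12∣3n⇒12∣4n⇒12∣n : ∀ {n} → + 12 ∣ˢ + 3 * n → + 12 ∣ˢ + 4 * n → + 12 ∣ˢ n
12∣3n⇒12∣4n⇒12∣n {n} 12∣3n 12∣4n =
  subst (+ 12 ∣ˢ_) {+ 4 * n - + 3 * n} (solve (n ∷ [])) (∣m∣n⇒∣m-n 12∣4n 12∣3n)

3∣n²-1⊎3∣n : ∀ n → + 3 ∣ˢ n * n - + 1 ⊎ + 3 ∣ˢ n
3∣n²-1⊎3∣n n = byResidue (n % + 3) (n / + 3) (n%d<d n (+ 3)) (a≡a%n+[a/n]*n n (+ 3))
  where
  byResidue : ∀ r q → r ℕ.< 3 → n ≡ + r + q * + 3 → + 3 ∣ˢ n * n - + 1 ⊎ + 3 ∣ˢ n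
  byResidue 0 q _ refl = inj₂ (divides q (solve (q ∷ [])))
  byResidue 1 q _ refl = inj₁ (divides (+ 3 * q * q + + 2 * q) (solve (q ∷ [])))
  byResidue 2 q _ refl = inj₁ (divides (+ 3 * q * q + + 4 * q + + 1) (solve (q ∷ [])))
  byResidue (ℕ.suc (ℕ.suc (ℕ.suc _))) _ (ℕ.s≤s (ℕ.s≤s (ℕ.s≤s ()))) _

4∣n²-1⊎2∣n : ∀ n → + 4 ∣ˢ n * n - + 1 ⊎ + 2 ∣ˢ n
4∣n²-1⊎2∣n n = byResidue (n % + 2) (n / + 2) (n%d<d n (+ 2)) (a≡a%n+[a/n]*n n (+ 2))
  where
  byResidue : ∀ r q → r ℕ.< 2 → n ≡ + r + q * + 2 → + 4 ∣ˢ n * n - + 1 ⊎ + 2 ∣ˢ n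
  byResidue 0 q _ refl = inj₂ (divides q (solve (q ∷ [])))
  byResidue 1 q _ refl = inj₁ (divides (q * q + q) (solve (q ∷ [])))
  byResidue (ℕ.suc (ℕ.suc _)) _ (ℕ.s≤s (ℕ.s≤s ())) _

mat-cong : ∀ {a b c d a′ b′ c′ d′} → a ≡ a′ → b ≡ b′ → c ≡ c′ → d ≡ d′ →
           mat a b c d ≡ mat a′ b′ c′ d′
mat-cong refl refl refl refl = refl

S^n≡ : ∀ n → S ^ n ≡ mat (+ 1) (+ n) (+ 0) (+ 1)
S^n≡ ℕ.zero    = refl
S^n≡ (ℕ.suc n) rewrite S^n≡ n = cong (λ x → mat (+ 1) x (+ 0) (+ 1)) (1*x+1*1≡1+x (+ n))
  where
  1*x+1*1≡1+x : ∀ x → + 1 * x + + 1 * + 1 ≡ + 1 + x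
  1*x+1*1≡1+x x = solve (x ∷ [])

inv-translation·M : ∀ x a b c d →
  inv (mat (+ 1) x (+ 0) (+ 1)) · mat a b c d ≡ mat (a - x * c) (b - x * d) c d
inv-translation·M x a b c d = mat-cong (top a c) (top b d) (bottom a c) (bottom b d)
  where
  top : ∀ y z → + 1 * y + - x * z ≡ y - x * z
  top y z = solve (x ∷ y ∷ z ∷ [])
  bottom : ∀ y z → + 0 * y + + 1 * z ≡ z
  bottom y z = solve (y ∷ z ∷ [])

∣c⇒∣d⇒∣det : ∀ {p} M → p ∣ˢ c M → p ∣ˢ d M → p ∣ˢ det M
∣c⇒∣d⇒∣det M p∣c p∣d = ∣m∣n⇒∣m-n (∣n⇒∣m*n (a M) p∣d) (∣n⇒∣m*n (b M) p∣c)

shiftDefect : Mat → ℤ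
shiftDefect M = (c M * c M - + 1) * (d M * d M - + 1)

f-shift : ∀ x a b c d →
  f (mat (a - x * c) (b - x * d) c d) ≡ f (mat a b c d) - x + x * shiftDefect (mat a b c d)
f-shift x a b c d with cOdd c
... | true = oddBranch
  where
  oddBranch : (a - x * c + d) * c - (b - x * d) * d * (c * c - + 1) - + 3 * c
            ≡ (a + d) * c - b * d * (c * c - + 1) - + 3 * c
              - x + x * ((c * c - + 1) * (d * d - + 1))
  oddBranch = solve (x ∷ a ∷ b ∷ c ∷ d ∷ [])
... | false = evenBranch
  where
  evenBranch : (a - x * c + d) * c - (b - x * d) * d * (c * c - + 1) + + 3 * d - + 3 - + 3 * c * d
             ≡ (a + d) * c - b * d * (c * c - + 1) + + 3 * d - + 3 - + 3 * c * d
               - x + x * ((c * c - + 1) * (d * d - + 1))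
  evenBranch = solve (x ∷ a ∷ b ∷ c ∷ d ∷ [])

f[S⁻ⁿM] : ∀ n M → f (inv (S ^ n) · M) ≡ f M - + n + + n * shiftDefect M
f[S⁻ⁿM] n (mat a b c d) = begin
  f (inv (S ^ n) · mat a b c d)
    ≡⟨ cong (λ T → f (inv T · mat a b c d)) (S^n≡ n) ⟩
  f (inv (mat (+ 1) (+ n) (+ 0) (+ 1)) · mat a b c d)
    ≡⟨ cong f (inv-translation·M (+ n) a b c d) ⟩
  f (mat (a - + n * c) (b - + n * d) c d)
    ≡⟨ f-shift (+ n) a b c d ⟩
  f (mat a b c d) - + n + + n * shiftDefect (mat a b c d) ∎
  where open ≡-Reasoning

∣shiftDefect : ∀ {p q} → ¬ p ∣ˢ + 1 → (∀ n → q ∣ˢ n * n - + 1 ⊎ p ∣ˢ n) →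
               ∀ M → InΓ1 M → q ∣ˢ shiftDefect M
∣shiftDefect {p} p∤1 q∣n²-1⊎p∣n M det≡1 with q∣n²-1⊎p∣n (c M) | q∣n²-1⊎p∣n (d M)
... | inj₁ q∣c²-1 | _           = ∣m⇒∣m*n (d M * d M - + 1) q∣c²-1
... | inj₂ _      | inj₁ q∣d²-1 = ∣n⇒∣m*n (c M * c M - + 1) q∣d²-1
... | inj₂ p∣c    | inj₂ p∣d    = ⊥-elim (p∤1 (subst (p ∣ˢ_) det≡1 (∣c⇒∣d⇒∣det M p∣c p∣d)))

12∣shiftDefect : ∀ M → InΓ1 M → + 12 ∣ˢ shiftDefect M
12∣shiftDefect M det≡1 =
  12∣3n⇒12∣4n⇒12∣n (*-monoʳ-∣ (+ 3) 4∣shiftDefect) (*-monoʳ-∣ (+ 4) 3∣shiftDefect)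
  where
  3∣shiftDefect : + 3 ∣ˢ shiftDefect M
  3∣shiftDefect = ∣shiftDefect (nonTrivial⇒∤1 3) 3∣n²-1⊎3∣n M det≡1
  4∣shiftDefect : + 4 ∣ˢ shiftDefect M
  4∣shiftDefect = ∣shiftDefect (nonTrivial⇒∤1 2) 4∣n²-1⊎2∣n M det≡1

k≡±1,±5⇒12∣k²-1 : ∀ k →
  (+ 12) ∣ (k - + 1) ⊎ (+ 12) ∣ (k + + 1) ⊎ (+ 12) ∣ (k - + 5) ⊎ (+ 12) ∣ (k + + 5) →
  + 12 ∣ˢ k * k - + 1
k≡±1,±5⇒12∣k²-1 k (inj₁ 12∣k-1)               = ∣k-s⇒∣k²-1 k (+ 1)   (∣ᵤ⇒∣ 12∣k-1) (divides (+ 0) refl)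
k≡±1,±5⇒12∣k²-1 k (inj₂ (inj₁ 12∣k+1))        = ∣k-s⇒∣k²-1 k (- + 1) (∣ᵤ⇒∣ 12∣k+1) (divides (+ 0) refl)
k≡±1,±5⇒12∣k²-1 k (inj₂ (inj₂ (inj₁ 12∣k-5))) = ∣k-s⇒∣k²-1 k (+ 5)   (∣ᵤ⇒∣ 12∣k-5) (divides (+ 2) refl)
k≡±1,±5⇒12∣k²-1 k (inj₂ (inj₂ (inj₂ 12∣k+5))) = ∣k-s⇒∣k²-1 k (- + 5) (∣ᵤ⇒∣ 12∣k+5) (divides (+ 2) refl)

InKer⇔12∣f : ∀ k M → + 12 ∣ˢ k * k - + 1 → InKer k M ⇔ + 12 ∣ˢ f M
InKer⇔12∣f k M 12∣k²-1 = mk⇔ (∣k*n⇒∣n k 12∣k²-1 ∘ ∣ᵤ⇒∣) (∣⇒∣ᵤ ∘ ∣n⇒∣m*n k)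

InKer3×InKer4⇔12∣f : ∀ M → (InKer (+ 3) M × InKer (+ 4) M) ⇔ + 12 ∣ˢ f M
InKer3×InKer4⇔12∣f M = mk⇔
  (λ (h₃ , h₄) → 12∣3n⇒12∣4n⇒12∣n (∣ᵤ⇒∣ h₃) (∣ᵤ⇒∣ h₄))
  (λ 12∣f → ∣⇒∣ᵤ (∣n⇒∣m*n (+ 3) 12∣f) , ∣⇒∣ᵤ (∣n⇒∣m*n (+ 4) 12∣f))

InKer⇔InKer3×InKer4 : ∀ k → + 12 ∣ˢ k * k - + 1 →
                      ∀ M → InKer k M ⇔ (InKer (+ 3) M × InKer (+ 4) M)
InKer⇔InKer3×InKer4 k 12∣k²-1 M =
  ⇔.trans (InKer⇔12∣f k M 12∣k²-1) (⇔.sym (InKer3×InKer4⇔12∣f M))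

InKer[S⁻ⁿM]⇔12∣f-n : ∀ k n M → + 12 ∣ˢ k * k - + 1 → InΓ1 M →
                     InKer k (inv (S ^ n) · M) ⇔ + 12 ∣ˢ f M - + n
InKer[S⁻ⁿM]⇔12∣f-n k n M 12∣k²-1 det≡1 =
  ⇔.trans (InKer⇔12∣f k (inv (S ^ n) · M) 12∣k²-1) 12∣f[S⁻ⁿM]⇔12∣f-n
  where
  12∣f[S⁻ⁿM]⇔12∣f-n : + 12 ∣ˢ f (inv (S ^ n) · M) ⇔ + 12 ∣ˢ f M - + n
  12∣f[S⁻ⁿM]⇔12∣f-n rewrite f[S⁻ⁿM] n M =
    ∣m+n⇔∣m (∣n⇒∣m*n (+ n) (12∣shiftDefect M det≡1))

coset-representative : ∀ k → + 12 ∣ˢ k * k - + 1 →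
                       ∀ M → InΓ1 M → ∃[ n ] InKer k (inv (S ^ toℕ {12} n) · M)
coset-representative k 12∣k²-1 M det≡1 =
  fromℕ< r<12 ,
  Equivalence.from (InKer[S⁻ⁿM]⇔12∣f-n k (toℕ (fromℕ< r<12)) M 12∣k²-1 det≡1) 12∣f-r
  where
  r<12 : f M % + 12 ℕ.< 12
  r<12 = n%d<d (f M) (+ 12)
  12∣f-r : + 12 ∣ˢ f M - + toℕ (fromℕ< r<12)
  12∣f-r rewrite toℕ-fromℕ< r<12 = n∣m-m%n (f M) (+ 12)

coset-representative-unique : ∀ k → + 12 ∣ˢ k * k - + 1 → ∀ M → InΓ1 M → (n m : Fin 12) →
  InKer k (inv (S ^ toℕ n) · M) → InKer k (inv (S ^ toℕ m) · M) → n ≡ m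
coset-representative-unique k 12∣k²-1 M det≡1 n m S⁻ⁿM∈Ker S⁻ᵐM∈Ker =
  toℕ-injective (residues-unique (toℕ<n n) (toℕ<n m) 12∣n-m)
  where
  12∣f-n : + 12 ∣ˢ f M - + toℕ n
  12∣f-n = Equivalence.to (InKer[S⁻ⁿM]⇔12∣f-n k (toℕ n) M 12∣k²-1 det≡1) S⁻ⁿM∈Ker
  12∣f-m : + 12 ∣ˢ f M - + toℕ m
  12∣f-m = Equivalence.to (InKer[S⁻ⁿM]⇔12∣f-n k (toℕ m) M 12∣k²-1 det≡1) S⁻ᵐM∈Ker
  F-y-[F-x]≡x-y : ∀ F x y → F - y - (F - x) ≡ x - y
  F-y-[F-x]≡x-y F x y = solve (F ∷ x ∷ y ∷ [])
  12∣n-m : + 12 ∣ˢ + toℕ n - + toℕ m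
  12∣n-m = subst (+ 12 ∣ˢ_) (F-y-[F-x]≡x-y (f M) (+ toℕ n) (+ toℕ m)) (∣m∣n⇒∣m-n 12∣f-m 12∣f-n)

mainTheorem7 : (k : ℤ) →
    ((+ 12) ∣ (k - + 1) ⊎ (+ 12) ∣ (k + + 1) ⊎ (+ 12) ∣ (k - + 5) ⊎ (+ 12) ∣ (k + + 5)) →
    ((M : Mat) → InΓ1 M → (InKer k M ⇔ (InKer (+ 3) M × InKer (+ 4) M)))
    × ((M : Mat) → InΓ1 M → ∃[ n ] InKer k (inv (S ^ toℕ {12} n) · M))
    × ((M : Mat) → InΓ1 M → (n m : Fin 12) →
         InKer k (inv (S ^ toℕ n) · M) → InKer k (inv (S ^ toℕ m) · M) → n ≡ m)
mainTheorem7 k k≡±1,±5 =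
  (λ M _ → InKer⇔InKer3×InKer4 k 12∣k²-1 M) ,
  coset-representative k 12∣k²-1 ,
  coset-representative-unique k 12∣k²-1
  where
  12∣k²-1 : + 12 ∣ˢ k * k - + 1
  12∣k²-1 = k≡±1,±5⇒12∣k²-1 k k≡±1,±5
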